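{- Let $P$ be a Horn mca-program and let $t$ be a $P$-computation. Then $R_t \subseteq \mathit{hset}(P(R_t))$.
   Context: Let $\mathit{At}$ be a set of propositional atoms. An mc-atom over $\mathit{At}$ is an expression $kX$, where $k$ is a non-negative integer and $X \subseteq \mathit{At}$ is finite with $k \leq |X|$; $\mathit{aset}(kX) = X$. An mc-literal is $A$ or $\mathbf{not}(A)$ for an mc-atom $A$. An mca-clause $r$ is an expression $H \leftarrow L_1, \ldots, L_m$ ($m \geq 0$), where $H$ is an mc-atom and the $L_i$ are mc-literals, with $\mathit{hd}(r) = H$, $\mathit{bd}(r) = \{L_1, \ldots, L_m\}$, and $\mathit{hset}(r) = \mathit{aset}(H)$. An mca-program is a set of mca-clauses. It is Horn if no clause body contains a literal of the form $\mathbf{not}(A)$. For a set $Q$ of clauses, $\mathit{hset}(Q) = \bigcup\{\mathit{hset}(r) : r \in Q\}$. Satisfaction, for $M \subseteq \mathit{At}$: - $M \models kX$ iff $|M \cap X| \geq k$. - $M \models \mathbf{not}(kX)$ iff $|M \cap X| < k$. - $M \models \mathit{bd}(r)$ iff $M$ satisfies all literals of $\mathit{bd}(r)$. Operators: - $P(M) = \{r \in P : M \models \mathit{bd}(r)\}$. - $T^{\mathit{nd}}_P(M)$ is the set of all $M'$ with $M' \subseteq \mathit{hset}(P(M))$ and $M' \models \mathit{hd}(r)$ for all $r \in P(M)$. For a Horn mca-program $P$, a $P$-computation is a sequence $(X_n)_{n=0,1,\ldots}$ of sets of atoms such that $X_0 = \emptyset$ and, for every $n \geq 0$, $X_n \subseteq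 X_{n+1}$ and $X_{n+1} \in T^{\mathit{nd}}_P(X_n)$. The result of a computation $t = (X_n)$ is $R_t = \bigcup_{n=0}^\infty X_n$. -}

module Defs where

open import Data.Nat using (ℕ; zero; suc; _≤_; _<_)
open import Data.List using (List; length)
open import Data.List.Membership.Propositional using (_∈_)
open import Data.List.Relation.Unary.All using (All)
open import Data.List.Relation.Unary.Unique.Propositional using (Unique)
open import Data.Product using (Σ; _×_; ∃)
open import Data.Empty using (⊥)
open import Data.Unit using (⊤)
open import Relation.Binary.PropositionalEquality using (_≡_)
open import Relation.Nullary using (¬_)

ASet : Set → Set₁
ASet At = At → Set

_⊆ₐ_ : {At : Set} → ASet At → ASet At → Set
M ⊆ₐ N = ∀ a → M a → N a

∅ₐ : {At : Set} → ASet At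
∅ₐ _ = ⊥

module _ {At : Set} where

  record MCAtom : Set where
    constructor mc
    field
      k      : ℕ
      X      : List At
      X-uniq : Unique X
      k≤∣X∣  : k ≤ length X
  open MCAtom public

  aset : MCAtom → ASet At
  aset A a = a ∈ X A

  data MCLit : Set where
    pos : MCAtom → MCLit
    neg : MCAtom → MCLit

  record Clause : Set where
    constructor _←_
    field
      hd : MCAtom
      bd : List MCLit
  open Clause public

  hset : Clause → ASet At
  hset r = aset (hd r)

  Program : Set₁
  Program = Clause → Set

  IsPos : MCLit → Set
  IsPos (pos _) = ⊤
  IsPos (neg _) = ⊥

  Horn : Program → Set
  Horn P = ∀ r → P r → All IsPos (bd r)

  -- |M ∩ X| ≥ k : there are k distinct elements of X lying in M
  AtLeast : ℕ → List At → ASet At → Set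
  AtLeast k X M = Σ (List At) λ Y → Unique Y × length Y ≡ k × All (_∈ X) Y × All M Y

  _⊨_ : ASet At → MCAtom → Set
  M ⊨ A = AtLeast (k A) (X A) M

  _⊨ₗ_ : ASet At → MCLit → Set
  M ⊨ₗ pos A = M ⊨ A
  M ⊨ₗ neg A = ¬ (M ⊨ A)

  _⊨b_ : ASet At → List MCLit → Set
  M ⊨b L = All (M ⊨ₗ_) L

  _at_ : Program → ASet At → Program
  (P at M) r = P r × (M ⊨b bd r)

  hsetP : Program → ASet At
  hsetP Q a = Σ Clause λ r → Q r × hset r a

  Tnd : Program → ASet At → ASet At → Set
  Tnd P M M' = (M' ⊆ₐ hsetP (P at M)) × (∀ r → (P at M) r → M' ⊨ hd r)

  IsComputation : Program → (ℕ → ASet At) → Set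
  IsComputation P Xs =
    (∀ a → ¬ Xs zero a) ×
    (∀ n → (Xs n ⊆ₐ Xs (suc n)) × Tnd P (Xs n) (Xs (suc n)))

  Result : (ℕ → ASet At) → ASet At
  Result Xs a = ∃ λ n → Xs n a

{-# OPTIONS --safe #-}
-- Every atom of the result enters at some step n+1, and is then in hset(P(X_n)).
-- In a Horn program P(M) grows with M, because satisfaction of mc-atoms is
-- monotone; since X_n ⊆ R_t, the clause that produced the atom also lies in P(R_t).
module Submission where

open import Defs
open import Data.Nat using (ℕ; zero; suc)
open import Data.Product using (_,_; proj₁; proj₂)
open import Data.Empty using (⊥-elim)
open import Data.List using (List)
open import Data.List.Relation.Unary.All using (All)
import Data.List.Relation.Unary.All as All

module _ {At : Set} where

  ⊨-mono : {M N : ASet At} → M ⊆ₐ N → (A : MCAtom {At}) → M ⊨ A → N ⊨ A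
  ⊨-mono M⊆N A (Y , Y-uniq , ∣Y∣≡k , Y⊆X , Y⊆M) =
    Y , Y-uniq , ∣Y∣≡k , Y⊆X , All.map (M⊆N _) Y⊆M

  ⊨ₗ-mono : {M N : ASet At} → M ⊆ₐ N → (L : MCLit {At}) → IsPos L → M ⊨ₗ L → N ⊨ₗ L
  ⊨ₗ-mono M⊆N (pos A) _ = ⊨-mono M⊆N A
  ⊨ₗ-mono M⊆N (neg A) ()

  ⊨b-mono : {M N : ASet At} → M ⊆ₐ N → {B : List (MCLit {At})} → All IsPos B → M ⊨b B → N ⊨b B
  ⊨b-mono M⊆N B-pos M⊨B =
    All.zipWith (λ (L-pos , M⊨L) → ⊨ₗ-mono M⊆N _ L-pos M⊨L) (B-pos , M⊨B)

  at-mono : (P : Program {At}) → Horn P → {M N : ASet At} → M ⊆ₐ N →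
            ∀ r → (P at M) r → (P at N) r
  at-mono P horn M⊆N r (r∈P , M⊨bd) = r∈P , ⊨b-mono M⊆N (horn r r∈P) M⊨bd

  hsetP-mono : {Q Q′ : Program {At}} → (∀ r → Q r → Q′ r) → hsetP Q ⊆ₐ hsetP Q′
  hsetP-mono Q⊆Q′ a (r , r∈Q , a∈hset) = r , Q⊆Q′ r r∈Q , a∈hset

  ⊆-Result : (t : ℕ → ASet At) (n : ℕ) → t n ⊆ₐ Result t
  ⊆-Result t n a a∈tn = n , a∈tn

  computation-step-⊆ : (P : Program {At}) (t : ℕ → ASet At) → IsComputation P t →
                       ∀ n → t (suc n) ⊆ₐ hsetP (P at t n)
  computation-step-⊆ P t (_ , step) n = proj₁ (proj₂ (step n))

proposition4 : {At : Set} (P : Program {At}) → Horn P →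
    (t : ℕ → ASet At) → IsComputation P t →
    Result t ⊆ₐ hsetP (P at Result t)
proposition4 P horn t (t₀-empty , _) a (zero , a∈t₀) = ⊥-elim (t₀-empty a a∈t₀)
proposition4 P horn t t-comp a (suc n , a∈tₙ₊₁) =
  hsetP-mono (at-mono P horn (⊆-Result t n)) a
    (computation-step-⊆ P t t-comp n a a∈tₙ₊₁)
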